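{- Let $n>h\geq 0$ be integers, and let $M_n^{(h)}$ be the number of edges of the Hasse diagram of the poset of independent sets of $\mathbf{C}_n^{(h)}$ ordered by inclusion. Then \[ M_n^{(h)}=\sum_{i=1}^{n-h} F_i^{(h)}L_{n-h-i+1}^{(h)}. \]
   Context: For $n,h\geq 0$, the $h$-power of a cycle $\mathbf{C}_n^{(h)}$ is the graph with vertices $v_1,\dots,v_n$ in which, for $i\neq j$, $v_i$ and $v_j$ are adjacent if and only if $|j-i|\leq h$ or $|j-i|\geq n-h$. An independent set of a graph is a subset of its vertex set containing no two adjacent vertices. The $h$-Fibonacci sequence $(F_n^{(h)})_{n\geq 1}$ is defined by $F_n^{(h)}=1$ for $1\leq n\leq h+1$ and $F_n^{(h)}=F_{n-1}^{(h)}+F_{n-h-1}^{(h)}$ for $n>h+1$. The $h$-Lucas sequence $(L_n^{(h)})_{n\geq 1}$ is defined by $L_1^{(h)}=h+1$, $L_n^{(h)}=1$ for $2\leq n\leq h+1$, and $L_n^{(h)}=L_{n-1}^{(h)}+L_{n-h-1}^{(h)}$ for $n>h+1$. -}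

module Defs where

open import Data.Nat using (ℕ; zero; suc; _+_; _*_; _∸_; _≤_; ∣_-_∣)
open import Data.Nat.Properties using (_≤?_)
open import Data.Fin using (Fin; toℕ)
open import Data.Fin.Properties using (all?) renaming (_≟_ to _≟ᶠ_)
open import Data.Fin.Subset using (Subset; _∈_; _⊂_; inside; outside)
open import Data.Fin.Subset.Properties using (_∈?_; _⊂?_; anySubset?)
open import Data.List using (List; []; _∷_; _++_; map; length; filter; cartesianProduct; upTo)
open import Data.Nat.ListAction using (sum)
open import Data.Vec using ([]; _∷_)
open import Data.Product using (_×_; _,_; ∃; proj₁; proj₂)
open import Data.Sum using (_⊎_)
open import Relation.Nullary using (¬_; Dec; does)
open import Relation.Nullary.Decidable using (_×-dec_; _⊎-dec_; _→-dec_; ¬?)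
open import Relation.Binary.PropositionalEquality using (_≡_; _≢_)
open import Data.Bool using (if_then_else_)

-- The h-power of a cycle C_n^(h): vertices Fin n (v_{i+1} ↔ i),
-- i ≠ j adjacent iff |j-i| ≤ h or |j-i| ≥ n-h.

Adj : (n h : ℕ) → Fin n → Fin n → Set
Adj n h i j = i ≢ j × (∣ toℕ j - toℕ i ∣ ≤ h ⊎ n ∸ h ≤ ∣ toℕ j - toℕ i ∣)

adj? : (n h : ℕ) (i j : Fin n) → Dec (Adj n h i j)
adj? n h i j = ¬? (i ≟ᶠ j) ×-dec ((∣ toℕ j - toℕ i ∣ ≤? h) ⊎-dec (n ∸ h ≤? ∣ toℕ j - toℕ i ∣))

Independent : (n h : ℕ) → Subset n → Set
Independent n h I = ∀ i j → i ∈ I → j ∈ I → ¬ Adj n h i j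

independent? : (n h : ℕ) (I : Subset n) → Dec (Independent n h I)
independent? n h I =
  all? (λ i → all? (λ j → (i ∈? I) →-dec ((j ∈? I) →-dec ¬? (adj? n h i j))))

Covers : (n h : ℕ) → Subset n → Subset n → Set
Covers n h I J =
  Independent n h I × Independent n h J × I ⊂ J ×
  ¬ (∃ λ K → Independent n h K × I ⊂ K × K ⊂ J)

covers? : (n h : ℕ) (I J : Subset n) → Dec (Covers n h I J)
covers? n h I J =
  independent? n h I ×-dec independent? n h J ×-dec (I ⊂? J) ×-dec
  ¬? (anySubset? (λ K → independent? n h K ×-dec (I ⊂? K) ×-dec (K ⊂? J)))

allSubsets : (n : ℕ) → List (Subset n)
allSubsets zero = [] ∷ []
allSubsets (suc n) = map (inside ∷_) (allSubsets n) ++ map (outside ∷_) (allSubsets n)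

M : (n h : ℕ) → ℕ
M n h = length (filter (λ p → covers? n h (proj₁ p) (proj₂ p))
                       (cartesianProduct (allSubsets n) (allSubsets n)))

-- h-Fibonacci and h-Lucas sequences (1-indexed; index 0 is unused).
-- Defined by recursion with fuel; fuel k suffices for indices ≤ k.

fibFuel : ℕ → ℕ → ℕ → ℕ
fibFuel zero    h m = 0
fibFuel (suc k) h m =
  if does (m ≤? suc h) then 1
  else fibFuel k h (m ∸ 1) + fibFuel k h (m ∸ suc h)

F : ℕ → ℕ → ℕ
F h m = fibFuel m h m

lucFuel : ℕ → ℕ → ℕ → ℕ
lucFuel zero    h m = 0
lucFuel (suc k) h m =
  if does (m ≤? 1) then suc h
  else if does (m ≤? suc h) then 1
  else lucFuel k h (m ∸ 1) + lucFuel k h (m ∸ suc h)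

L : ℕ → ℕ → ℕ
L h m = lucFuel m h m

fibLucSum : (n h : ℕ) → ℕ
fibLucSum n h = sum (map (λ i → F h i * L h (n ∸ h ∸ i + 1)) (map suc (upTo (n ∸ h))))

module Submission where

-- Both sides are shown to equal n · F_{n-h}.
--
-- The Lucas numbers are Fibonacci combinations,
-- L_{m+2} = F_{m+1} + (h+1) F_{m+1-h} (with F_0 = 0).  Splitting F_{i+1} =
-- F_i + F_{i-h} inside the convolution A_m = Σ_{i=1}^m F_i L_{m-i+1} gives
-- A_{m+1} = L_{m+1} + A_m + A_{m-h}, whence A_m = (m+h) F_m by strong induction.
--
-- I ⋖ J is a covering pair iff J is independent and I is J minus
-- one element, so M = Σ_{J independent} |J| = Σ_v #{J independent : v ∈ J}.
-- Independence is a gap condition on positions which is invariant under rotating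
-- the cycle, so every vertex v lies in as many independent sets as vertex 0.  An
-- independent set through 0 is 0 plus an h-sparse set of a path of n-2h-1
-- vertices, and there are F_{n-h} of those.  Hence M = n · F_{n-h}.

open import Defs
open import Data.Nat using (ℕ; zero; suc; _+_; _*_; _∸_; _⊓_; _≤_; _<_; z≤n; s≤s; s≤s⁻¹; compare; less; equal; greater)
open import Data.Nat.Properties
open import Data.Nat.Induction using (<-rec)
open import Data.Nat.Tactic.RingSolver using (solve-∀)
open import Data.Nat.ListAction using (sum)
open import Data.Nat.ListAction.Properties using (sum-++)
open import Data.Bool using (Bool; true; false; _∧_; T; if_then_else_)
open import Data.Unit using (tt)
open import Data.List using (List; []; _∷_; _++_; map; length; filter; cartesianProduct; applyUpTo)
open import Data.List.Properties using (map-++; map-∘; map-cong)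
open import Data.Vec using ([]; _∷_; _∷ʳ_; here; there)
open import Data.Fin using (Fin; zero; suc; toℕ)
open import Data.Fin.Properties using (toℕ-injective) renaming (_≟_ to _≟ᶠ_)
open import Data.Fin.Subset using (Subset; inside; outside; _∈_; _∉_; _⊆_; _⊂_; _-_; ⁅_⁆; ∣_∣)
open import Data.Fin.Subset.Properties using (_∈?_; ⊆-antisym; p─q⊆p; p─⊥≡p; x∈p⇒p-x⊂p; x∈p∧x≢y⇒x∈p-y)
open import Data.Product using (_×_; _,_; ∃; proj₁; proj₂)
open import Data.Sum using (_⊎_; inj₁; inj₂)
open import Data.Empty using (⊥-elim)
open import Function using (_∘_)
open import Function.Bundles using (_⇔_; mk⇔; Equivalence)
open import Function.Construct.Composition using (_⇔-∘_)
open import Function.Construct.Symmetry using (⇔-sym)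
open import Relation.Unary using (Decidable)
open import Relation.Nullary using (Dec; yes; no; does; ¬_; contradiction; T?)
open import Relation.Nullary.Decidable using (dec-true; dec-false; does-⇔; _×-dec_)
open import Relation.Binary.PropositionalEquality using (_≡_; refl; sym; trans; cong; cong₂; subst; subst₂; module ≡-Reasoning)
open import Relation.Binary.Definitions using (tri<; tri≈; tri>)

open ≡-Reasoning

private
  variable
    A B : Set

+-∸-cancel : ∀ k h t → k + (h + t) ∸ h ≡ k + t
+-∸-cancel k h t = trans (+-∸-assoc k (m≤m+n h t)) (cong (k +_) (m+n∸m≡n h t))

if-yes : ∀ {P : Set} (P? : Dec P) {a b : ℕ} → P → (if does P? then a else b) ≡ a
if-yes P? p rewrite dec-true P? p = refl

if-no : ∀ {P : Set} (P? : Dec P) {a b : ℕ} → ¬ P → (if does P? then a else b) ≡ b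
if-no P? ¬p rewrite dec-false P? ¬p = refl

fibFuel-initial : ∀ k h {m} → m ≤ suc h → fibFuel (suc k) h m ≡ 1
fibFuel-initial k h {m} m≤h = if-yes (m ≤? suc h) m≤h

fibFuel-step : ∀ k h {m} → suc h < m →
               fibFuel (suc k) h m ≡ fibFuel k h (m ∸ 1) + fibFuel k h (m ∸ suc h)
fibFuel-step k h {m} h<m = if-no (m ≤? suc h) (<⇒≱ h<m)

lucFuel-initial : ∀ k h {m} → 1 < m → m ≤ suc h → lucFuel (suc k) h m ≡ 1
lucFuel-initial k h {m} 1<m m≤h = trans (if-no (m ≤? 1) (<⇒≱ 1<m)) (if-yes (m ≤? suc h) m≤h)

lucFuel-step : ∀ k h {m} → suc h < m →
               lucFuel (suc k) h m ≡ lucFuel k h (m ∸ 1) + lucFuel k h (m ∸ suc h)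
lucFuel-step k h {m} h<m =
  trans (if-no (m ≤? 1) (<⇒≱ (≤-trans (s≤s (s≤s z≤n)) h<m))) (if-no (m ≤? suc h) (<⇒≱ h<m))

-- The recursive indices m - (d+1), for d ≤ h, of a fuelled call at index
-- h + 1 < m ≤ k + 1 lie in [1, k].
lag-positive : ∀ {d h m} → d ≤ h → suc h < m → 1 ≤ m ∸ suc d
lag-positive d≤h h<m = m<n⇒0<n∸m (≤-<-trans (s≤s d≤h) h<m)

lag-bound : ∀ d {m k} → m ≤ suc k → m ∸ suc d ≤ k
lag-bound d {m} m≤k = ≤-trans (∸-monoʳ-≤ m (s≤s z≤n)) (∸-monoˡ-≤ 1 m≤k)

-- The fuelled definitions do not depend on the fuel once it reaches the index;
-- this turns the defining clauses into equations for F and L.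
fibFuel-irrelevant : ∀ h {k k′ m} → 1 ≤ m → m ≤ k → m ≤ k′ → fibFuel k h m ≡ fibFuel k′ h m
fibFuel-irrelevant h {zero}  {_}     {suc _} _ () _
fibFuel-irrelevant h {suc _} {zero}  {suc _} _ _ ()
fibFuel-irrelevant h {suc k} {suc k′} {m} _ m≤k m≤k′ with m ≤? suc h
... | yes m≤h = trans (fibFuel-initial k h m≤h) (sym (fibFuel-initial k′ h m≤h))
... | no m≰h = begin
  fibFuel (suc k) h m
    ≡⟨ fibFuel-step k h h<m ⟩
  fibFuel k h (m ∸ 1) + fibFuel k h (m ∸ suc h)
    ≡⟨ cong₂ _+_ (fibFuel-irrelevant h (lag-positive z≤n h<m) (lag-bound 0 m≤k) (lag-bound 0 m≤k′))
                 (fibFuel-irrelevant h (lag-positive ≤-refl h<m) (lag-bound h m≤k) (lag-bound h m≤k′)) ⟩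
  fibFuel k′ h (m ∸ 1) + fibFuel k′ h (m ∸ suc h)
    ≡⟨ sym (fibFuel-step k′ h h<m) ⟩
  fibFuel (suc k′) h m ∎
  where
  h<m : suc h < m
  h<m = ≰⇒> m≰h

lucFuel-irrelevant : ∀ h {k k′ m} → 1 ≤ m → m ≤ k → m ≤ k′ → lucFuel k h m ≡ lucFuel k′ h m
lucFuel-irrelevant h {zero}  {_}     {suc _} _ () _
lucFuel-irrelevant h {suc _} {zero}  {suc _} _ _ ()
lucFuel-irrelevant h {suc k} {suc k′} {suc zero} _ _ _ = refl
lucFuel-irrelevant h {suc k} {suc k′} {m@(suc (suc _))} _ m≤k m≤k′ with m ≤? suc h
... | yes m≤h = trans (lucFuel-initial k h (s≤s (s≤s z≤n)) m≤h)
                      (sym (lucFuel-initial k′ h (s≤s (s≤s z≤n)) m≤h))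
... | no m≰h = begin
  lucFuel (suc k) h m
    ≡⟨ lucFuel-step k h h<m ⟩
  lucFuel k h (m ∸ 1) + lucFuel k h (m ∸ suc h)
    ≡⟨ cong₂ _+_ (lucFuel-irrelevant h (lag-positive z≤n h<m) (lag-bound 0 m≤k) (lag-bound 0 m≤k′))
                 (lucFuel-irrelevant h (lag-positive ≤-refl h<m) (lag-bound h m≤k) (lag-bound h m≤k′)) ⟩
  lucFuel k′ h (m ∸ 1) + lucFuel k′ h (m ∸ suc h)
    ≡⟨ sym (lucFuel-step k′ h h<m) ⟩
  lucFuel (suc k′) h m ∎
  where
  h<m : suc h < m
  h<m = ≰⇒> m≰h

F-initial : ∀ h {m} → 1 ≤ m → m ≤ suc h → F h m ≡ 1
F-initial h {suc m} _ m≤h = fibFuel-initial m h m≤h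

F-step : ∀ h {m} → h < m → F h (suc m) ≡ F h m + F h (m ∸ h)
F-step h {m} h<m = trans (fibFuel-step m h (s≤s h<m))
  (cong (F h m +_) (fibFuel-irrelevant h (m<n⇒0<n∸m h<m) (m∸n≤m m h) ≤-refl))

-- With F_0 = 0 the recurrence F_{m+2} = F_{m+1} + F_{m+1-h} holds for every m.
F-rec : ∀ h m → F h (suc (suc m)) ≡ F h (suc m) + F h (suc m ∸ h)
F-rec h m with h <? suc m
... | yes h<m = F-step h h<m
... | no h≮m = begin
  F h (suc (suc m))             ≡⟨ F-initial h (s≤s z≤n) (s≤s m<h) ⟩
  1                             ≡⟨ sym (F-initial h (s≤s z≤n) (m≤n⇒m≤1+n m<h)) ⟩
  F h (suc m)                   ≡⟨ sym (+-identityʳ _) ⟩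
  F h (suc m) + F h 0           ≡⟨ cong (λ i → F h (suc m) + F h i) (sym (m≤n⇒m∸n≡0 m<h)) ⟩
  F h (suc m) + F h (suc m ∸ h) ∎
  where
  m<h : suc m ≤ h
  m<h = ≮⇒≥ h≮m

L-initial : ∀ h {m} → 2 ≤ m → m ≤ suc h → L h m ≡ 1
L-initial h {suc m} 1<m m≤h = lucFuel-initial m h 1<m m≤h

L-step : ∀ h {m} → h < suc m → L h (suc (suc m)) ≡ L h (suc m) + L h (suc m ∸ h)
L-step h {m} h<m = trans (lucFuel-step (suc m) h (s≤s h<m))
  (cong (L h (suc m) +_) (lucFuel-irrelevant h (m<n⇒0<n∸m h<m) (m∸n≤m (suc m) h) ≤-refl))

-- L_{h+1} = 1 (for h = 0 this is L_1 = h + 1 = 1).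
L-at-suc-h : ∀ h → L h (suc h) ≡ 1
L-at-suc-h zero    = refl
L-at-suc-h (suc h) = L-initial (suc h) (s≤s (s≤s z≤n)) ≤-refl

LucasFibonacci : ℕ → ℕ → Set
LucasFibonacci h m = L h (suc (suc m)) ≡ F h (suc m) + suc h * F h (suc m ∸ h)

-- Strong induction step: for m < h both sides are initial values, for m = h one
-- unfolding of L suffices, and for m > h the recurrences of L and F match.
lucasFibonacci-step : ∀ h m → (∀ {m′} → m′ < m → LucasFibonacci h m′) → LucasFibonacci h m
lucasFibonacci-step h m ih with compare m h
... | less m k = begin
  L h (suc (suc m))                      ≡⟨ L-initial h (s≤s (s≤s z≤n)) (s≤s (s≤s (m≤m+n m k))) ⟩
  1                                      ≡⟨ sym (F-initial h (s≤s z≤n) (s≤s (m≤n⇒m≤1+n (m≤m+n m k)))) ⟩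
  F h (suc m)                           ≡⟨ sym (trans (cong (F h (suc m) +_) (*-zeroʳ (suc h))) (+-identityʳ _)) ⟩
  F h (suc m) + suc h * 0                ≡⟨ cong (λ i → F h (suc m) + suc h * F h i) (sym (m≤n⇒m∸n≡0 (m≤m+n m k))) ⟩
  F h (suc m) + suc h * F h (suc m ∸ h)  ∎
... | equal h = begin
  L h (suc (suc h))                      ≡⟨ L-step h (n<1+n h) ⟩
  L h (suc h) + L h (suc h ∸ h)          ≡⟨ cong₂ (λ a i → a + L h i) (L-at-suc-h h) (m+n∸n≡m 1 h) ⟩
  1 + suc h                              ≡⟨ cong₂ _+_ (sym (F-initial h (s≤s z≤n) ≤-refl)) (sym (*-identityʳ (suc h))) ⟩
  F h (suc h) + suc h * F h 1            ≡⟨ cong (λ i → F h (suc h) + suc h * F h i) (sym (m+n∸n≡m 1 h)) ⟩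
  F h (suc h) + suc h * F h (suc h ∸ h)  ∎
... | greater h t = begin
  L h (suc (suc m))                                   ≡⟨ L-step h (m≤n⇒m≤1+n (s≤s (m≤m+n h t))) ⟩
  L h (suc m) + L h (suc m ∸ h)                       ≡⟨ cong (λ i → L h (suc m) + L h i) (+-∸-cancel 2 h t) ⟩
  L h (suc m) + L h (suc (suc t))                     ≡⟨ cong₂ _+_ (ih (n<1+n (h + t))) (ih (s≤s (m≤n+m t h))) ⟩
  (F h m + c * F h (m ∸ h)) + (F h (suc t) + c * F h (suc t ∸ h))
                                                      ≡⟨ cong (λ i → (F h m + c * F h i) + (F h (suc t) + c * F h (suc t ∸ h))) (+-∸-cancel 1 h t) ⟩
  (F h m + c * F h (suc t)) + (F h (suc t) + c * F h (suc t ∸ h))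
                                                      ≡⟨ regroup (F h m) c (F h (suc t)) (F h (suc t ∸ h)) ⟩
  (F h m + F h (suc t)) + c * (F h (suc t) + F h (suc t ∸ h))
                                                      ≡⟨ cong₂ (λ a b → a + c * b) fib-m (sym (F-rec h t)) ⟩
  F h (suc m) + c * F h (suc (suc t))                 ≡⟨ cong (λ i → F h (suc m) + c * F h i) (sym (+-∸-cancel 2 h t)) ⟩
  F h (suc m) + c * F h (suc m ∸ h)                   ∎
  where
  c : ℕ
  c = suc h
  regroup : ∀ a c x y → (a + c * x) + (x + c * y) ≡ (a + x) + c * (x + y)
  regroup = solve-∀
  fib-m : F h m + F h (suc t) ≡ F h (suc m)
  fib-m = trans (cong (λ i → F h m + F h i) (sym (+-∸-cancel 1 h t))) (sym (F-rec h (h + t)))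

Lucas-Fibonacci : ∀ h m → L h (suc (suc m)) ≡ F h (suc m) + suc h * F h (suc m ∸ h)
Lucas-Fibonacci h = <-rec (LucasFibonacci h) (lucasFibonacci-step h)

∑< : ℕ → (ℕ → ℕ) → ℕ
∑< zero    g = 0
∑< (suc k) g = g 0 + ∑< k (λ i → g (suc i))

infix 5 ∑<
syntax ∑< k (λ i → e) = ∑[ i < k ] e

∑-cong : ∀ k {f g : ℕ → ℕ} → (∀ i → i < k → f i ≡ g i) → ∑< k f ≡ ∑< k g
∑-cong zero    f≡g = refl
∑-cong (suc k) f≡g = cong₂ _+_ (f≡g 0 (s≤s z≤n)) (∑-cong k (λ i i<k → f≡g (suc i) (s≤s i<k)))

interchange : ∀ a b c d → (a + b) + (c + d) ≡ (a + c) + (b + d)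
interchange = solve-∀

∑-+ : ∀ k (f g : ℕ → ℕ) → (∑[ i < k ] f i + g i) ≡ ∑< k f + ∑< k g
∑-+ zero    f g = refl
∑-+ (suc k) f g = trans (cong (f 0 + g 0 +_) (∑-+ k (λ i → f (suc i)) (λ i → g (suc i))))
                        (interchange (f 0) (g 0) _ _)

∑-const : ∀ k c → (∑[ i < k ] c) ≡ k * c
∑-const zero    c = refl
∑-const (suc k) c = cong (c +_) (∑-const k c)

∑-*ˡ : ∀ c k (f : ℕ → ℕ) → c * ∑< k f ≡ (∑[ i < k ] c * f i)
∑-*ˡ c zero    f = *-zeroʳ c
∑-*ˡ c (suc k) f = trans (*-distribˡ-+ c (f 0) _) (cong (c * f 0 +_) (∑-*ˡ c k (λ i → f (suc i))))

∑-drop : ∀ d k (g : ℕ → ℕ) → (∀ i → i < d → g i ≡ 0) → ∑< k g ≡ (∑[ t < k ∸ d ] g (t + d))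
∑-drop zero    k       g _  = ∑-cong k (λ i _ → cong g (sym (+-identityʳ i)))
∑-drop (suc d) zero    g _  = refl
∑-drop (suc d) (suc k) g g0 = begin
  g 0 + (∑[ i < k ] g (suc i))       ≡⟨ cong (_+ (∑[ i < k ] g (suc i))) (g0 0 (s≤s z≤n)) ⟩
  ∑[ i < k ] g (suc i)               ≡⟨ ∑-drop d k (λ i → g (suc i)) (λ i i<d → g0 (suc i) (s≤s i<d)) ⟩
  ∑[ t < k ∸ d ] g (suc (t + d))     ≡⟨ ∑-cong (k ∸ d) (λ t _ → cong g (sym (+-suc t d))) ⟩
  ∑[ t < k ∸ d ] g (t + suc d)       ∎

sum-map-suc-applyUpTo : ∀ (g f : ℕ → ℕ) k →
  sum (map g (map suc (applyUpTo f k))) ≡ (∑[ j < k ] g (suc (f j)))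
sum-map-suc-applyUpTo g f zero    = refl
sum-map-suc-applyUpTo g f (suc k) = cong (g (suc (f 0)) +_) (sum-map-suc-applyUpTo g (λ i → f (suc i)) k)

convolution : ℕ → ℕ → ℕ
convolution h m = ∑[ j < m ] F h (suc j) * L h (m ∸ suc j + 1)

fibLucSum-convolution : ∀ n h → fibLucSum n h ≡ convolution h (n ∸ h)
fibLucSum-convolution n h = sum-map-suc-applyUpTo (λ i → F h i * L h (n ∸ h ∸ i + 1)) (λ i → i) (n ∸ h)

-- Splitting F_{j+2} = F_{j+1} + F_{j+1-h} inside the convolution gives
-- A_{m+1} = L_{m+1} + A_m + A_{m-h}.
convolution-rec : ∀ h m → convolution h (suc m) ≡ L h (suc m) + convolution h m + convolution h (m ∸ h)
convolution-rec h m = begin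
  F h 1 * L h (m + 1) + (∑[ j < m ] F h (suc (suc j)) * l j)
    ≡⟨ cong₂ _+_ first (∑-cong m (λ j _ → split j)) ⟩
  L h (suc m) + (∑[ j < m ] F h (suc j) * l j + F h (suc j ∸ h) * l j)
    ≡⟨ cong (L h (suc m) +_) (∑-+ m (λ j → F h (suc j) * l j) (λ j → F h (suc j ∸ h) * l j)) ⟩
  L h (suc m) + (convolution h m + (∑[ j < m ] F h (suc j ∸ h) * l j))
    ≡⟨ sym (+-assoc (L h (suc m)) _ _) ⟩
  L h (suc m) + convolution h m + (∑[ j < m ] F h (suc j ∸ h) * l j)
    ≡⟨ cong (L h (suc m) + convolution h m +_) shifted ⟩
  L h (suc m) + convolution h m + convolution h (m ∸ h) ∎
  where
  l : ℕ → ℕ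
  l j = L h (m ∸ suc j + 1)
  first : F h 1 * L h (m + 1) ≡ L h (suc m)
  first = trans (*-identityˡ _) (cong (L h) (+-comm m 1))
  split : ∀ j → F h (suc (suc j)) * l j ≡ F h (suc j) * l j + F h (suc j ∸ h) * l j
  split j = trans (cong (_* l j) (F-rec h j)) (*-distribʳ-+ (l j) (F h (suc j)) _)
  -- the first h terms vanish since F_0 = 0; the rest are the terms of A_{m-h}
  reindex : ∀ t → F h (suc (t + h) ∸ h) * l (t + h) ≡ F h (suc t) * L h (m ∸ h ∸ suc t + 1)
  reindex t = cong₂ (λ a b → F h a * L h (b + 1))
                    (m+n∸n≡m (suc t) h)
                    (trans (cong (m ∸_) (+-comm (suc t) h)) (sym (∸-+-assoc m h (suc t))))
  shifted : (∑[ j < m ] F h (suc j ∸ h) * l j) ≡ convolution h (m ∸ h)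
  shifted = trans (∑-drop h m _ (λ j j<h → cong (λ i → F h i * l j) (m≤n⇒m∸n≡0 j<h)))
                  (∑-cong (m ∸ h) (λ t _ → reindex t))

-- (m - h + h) F_{m-h} = m F_{m-h}, since F_{m-h} = F_0 = 0 when m < h.
truncated-weight : ∀ h m → (m ∸ h + h) * F h (m ∸ h) ≡ m * F h (m ∸ h)
truncated-weight h m with h ≤? m
... | yes h≤m = cong (_* F h (m ∸ h)) (m∸n+n≡m h≤m)
... | no h≰m = trans (cong (λ i → (i + h) * F h i) m∸h≡0)
                     (trans (*-zeroʳ h) (sym (trans (cong (λ i → m * F h i) m∸h≡0) (*-zeroʳ m))))
  where
  m∸h≡0 : m ∸ h ≡ 0
  m∸h≡0 = m≤n⇒m∸n≡0 (<⇒≤ (≰⇒> h≰m))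

ConvolutionClosed : ℕ → ℕ → Set
ConvolutionClosed h m = convolution h m ≡ (m + h) * F h m

-- Strong induction: A_0 = 0, A_1 = F_1 L_1 = h + 1, and for m ≥ 2 the recurrence
-- of A together with the Lucas–Fibonacci identity and F_{m+1} = F_m + F_{m-h}.
convolution-closed-step : ∀ h m → (∀ {m′} → m′ < m → ConvolutionClosed h m′) → ConvolutionClosed h m
convolution-closed-step h zero          _  = sym (*-zeroʳ h)
convolution-closed-step h (suc zero)    _  = trans (+-identityʳ _) (trans (*-identityˡ _) (sym (*-identityʳ _)))
convolution-closed-step h (suc (suc m)) ih = begin
  convolution h (suc (suc m))
    ≡⟨ convolution-rec h (suc m) ⟩
  L h (suc (suc m)) + convolution h (suc m) + convolution h (suc m ∸ h)
    ≡⟨ cong₂ (λ a b → L h (suc (suc m)) + a + b) (ih (n<1+n (suc m))) (ih (s≤s (m∸n≤m (suc m) h))) ⟩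
  L h (suc (suc m)) + (suc m + h) * x + (suc m ∸ h + h) * y
    ≡⟨ cong₂ (λ a b → a + (suc m + h) * x + b) (Lucas-Fibonacci h m) (truncated-weight h (suc m)) ⟩
  (x + suc h * y) + (suc m + h) * x + suc m * y
    ≡⟨ collect h m x y ⟩
  (suc (suc m) + h) * (x + y)
    ≡⟨ cong ((suc (suc m) + h) *_) (sym (F-rec h m)) ⟩
  (suc (suc m) + h) * F h (suc (suc m)) ∎
  where
  x y : ℕ
  x = F h (suc m)
  y = F h (suc m ∸ h)
  collect : ∀ h m x y → (x + suc h * y) + (suc m + h) * x + suc m * y ≡ (suc (suc m) + h) * (x + y)
  collect = solve-∀

convolution-closed : ∀ h m → convolution h m ≡ (m + h) * F h m
convolution-closed h = <-rec (ConvolutionClosed h) (convolution-closed-step h)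

fibLucSum-closed : ∀ n h → h < n → fibLucSum n h ≡ n * F h (n ∸ h)
fibLucSum-closed n h h<n = begin
  fibLucSum n h                  ≡⟨ fibLucSum-convolution n h ⟩
  convolution h (n ∸ h)          ≡⟨ convolution-closed h (n ∸ h) ⟩
  (n ∸ h + h) * F h (n ∸ h)      ≡⟨ cong (_* F h (n ∸ h)) (m∸n+n≡m (<⇒≤ h<n)) ⟩
  n * F h (n ∸ h)                ∎

𝟙 : Bool → ℕ
𝟙 true  = 1
𝟙 false = 0

𝟙-∧ : ∀ a b → 𝟙 (a ∧ b) ≡ 𝟙 a * 𝟙 b
𝟙-∧ true  b = sym (+-identityʳ (𝟙 b))
𝟙-∧ false b = refl

sum-map-cong : ∀ {f g : A → ℕ} xs → (∀ x → f x ≡ g x) → sum (map f xs) ≡ sum (map g xs)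
sum-map-cong xs f≗g = cong sum (map-cong f≗g xs)

sum-map-++ : ∀ (f : A → ℕ) xs ys → sum (map f (xs ++ ys)) ≡ sum (map f xs) + sum (map f ys)
sum-map-++ f xs ys = trans (cong sum (map-++ f xs ys)) (sum-++ (map f xs) (map f ys))

sum-map-∘ : ∀ (f : B → ℕ) (g : A → B) xs → sum (map f (map g xs)) ≡ sum (map (f ∘ g) xs)
sum-map-∘ f g xs = cong sum (sym (map-∘ xs))

sum-map-zero : ∀ (xs : List A) → sum (map (λ _ → 0) xs) ≡ 0
sum-map-zero []       = refl
sum-map-zero (x ∷ xs) = sum-map-zero xs

sum-map-+ : ∀ (f g : A → ℕ) xs → sum (map (λ x → f x + g x) xs) ≡ sum (map f xs) + sum (map g xs)
sum-map-+ f g []       = refl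
sum-map-+ f g (x ∷ xs) = trans (cong (f x + g x +_) (sum-map-+ f g xs)) (interchange (f x) (g x) _ _)

sum-map-*ˡ : ∀ c (f : A → ℕ) xs → sum (map (λ x → c * f x) xs) ≡ c * sum (map f xs)
sum-map-*ˡ c f []       = sym (*-zeroʳ c)
sum-map-*ˡ c f (x ∷ xs) = trans (cong (c * f x +_) (sum-map-*ˡ c f xs)) (sym (*-distribˡ-+ c (f x) _))

sum-map-comm : ∀ (f : A → B → ℕ) xs ys →
  sum (map (λ x → sum (map (f x) ys)) xs) ≡ sum (map (λ y → sum (map (λ x → f x y) xs)) ys)
sum-map-comm f []       ys = sym (sum-map-zero ys)
sum-map-comm f (x ∷ xs) ys = begin
  sum (map (f x) ys) + sum (map (λ x′ → sum (map (f x′) ys)) xs)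
    ≡⟨ cong (sum (map (f x) ys) +_) (sum-map-comm f xs ys) ⟩
  sum (map (f x) ys) + sum (map (λ y → sum (map (λ x′ → f x′ y) xs)) ys)
    ≡⟨ sym (sum-map-+ (f x) (λ y → sum (map (λ x′ → f x′ y) xs)) ys) ⟩
  sum (map (λ y → f x y + sum (map (λ x′ → f x′ y) xs)) ys) ∎

sum-map-∑< : ∀ k (f : A → ℕ → ℕ) xs →
  sum (map (λ x → ∑< k (f x)) xs) ≡ (∑[ i < k ] sum (map (λ x → f x i) xs))
sum-map-∑< zero    f xs = sum-map-zero xs
sum-map-∑< (suc k) f xs = trans (sum-map-+ (λ x → f x 0) (λ x → ∑< k (λ i → f x (suc i))) xs)
  (cong (sum (map (λ x → f x 0) xs) +_) (sum-map-∑< k (λ x i → f x (suc i)) xs))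

sum-map-cartesianProduct : ∀ (f : A × B → ℕ) xs ys →
  sum (map f (cartesianProduct xs ys)) ≡ sum (map (λ x → sum (map (λ y → f (x , y)) ys)) xs)
sum-map-cartesianProduct f []       ys = refl
sum-map-cartesianProduct f (x ∷ xs) ys =
  trans (sum-map-++ f (map (x ,_) ys) (cartesianProduct xs ys))
        (cong₂ _+_ (sum-map-∘ f (x ,_) ys) (sum-map-cartesianProduct f xs ys))

length-filter : ∀ {P : A → Set} (P? : Decidable P) xs →
  length (filter P? xs) ≡ sum (map (λ x → 𝟙 (does (P? x))) xs)
length-filter P? []       = refl
length-filter P? (x ∷ xs) with does (P? x)
... | true  = cong suc (length-filter P? xs)
... | false = length-filter P? xs

∑⊆ : ∀ n → (Subset n → ℕ) → ℕ
∑⊆ n g = sum (map g (allSubsets n))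

infix 5 ∑⊆
syntax ∑⊆ n (λ X → e) = ∑[ X ⊆ n ] e

∑⊆-∷ : ∀ n (g : Subset (suc n) → ℕ) →
  ∑⊆ (suc n) g ≡ (∑[ X ⊆ n ] g (inside ∷ X)) + (∑[ X ⊆ n ] g (outside ∷ X))
∑⊆-∷ n g = trans (sum-map-++ g (map (inside ∷_) (allSubsets n)) _)
                 (cong₂ _+_ (sum-map-∘ g (inside ∷_) (allSubsets n)) (sum-map-∘ g (outside ∷_) (allSubsets n)))

∑⊆-∷ʳ : ∀ n (g : Subset (suc n) → ℕ) →
  ∑⊆ (suc n) g ≡ (∑[ X ⊆ n ] g (X ∷ʳ inside)) + (∑[ X ⊆ n ] g (X ∷ʳ outside))
∑⊆-∷ʳ zero    g = ∑⊆-∷ 0 g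
∑⊆-∷ʳ (suc n) g = begin
  ∑⊆ (suc (suc n)) g
    ≡⟨ ∑⊆-∷ (suc n) g ⟩
  (∑[ X ⊆ suc n ] g (inside ∷ X)) + (∑[ X ⊆ suc n ] g (outside ∷ X))
    ≡⟨ cong₂ _+_ (∑⊆-∷ʳ n (λ X → g (inside ∷ X))) (∑⊆-∷ʳ n (λ X → g (outside ∷ X))) ⟩
  (ii + io) + (oi + oo)
    ≡⟨ interchange ii io oi oo ⟩
  (ii + oi) + (io + oo)
    ≡⟨ sym (cong₂ _+_ (∑⊆-∷ n (λ X → g (X ∷ʳ inside))) (∑⊆-∷ n (λ X → g (X ∷ʳ outside)))) ⟩
  (∑[ X ⊆ suc n ] g (X ∷ʳ inside)) + (∑[ X ⊆ suc n ] g (X ∷ʳ outside)) ∎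
  where
  ii io oi oo : ℕ
  ii = ∑[ X ⊆ n ] g (inside ∷ (X ∷ʳ inside))
  io = ∑[ X ⊆ n ] g (inside ∷ (X ∷ʳ outside))
  oi = ∑[ X ⊆ n ] g (outside ∷ (X ∷ʳ inside))
  oo = ∑[ X ⊆ n ] g (outside ∷ (X ∷ʳ outside))

rotate : ∀ {m} → Subset (suc m) → Subset (suc m)
rotate (x ∷ X) = X ∷ʳ x

-- Rotation permutes the subsets, so it does not change a subset sum.
∑⊆-rotate : ∀ n (g : Subset (suc n) → ℕ) → (∑[ X ⊆ suc n ] g (rotate X)) ≡ ∑⊆ (suc n) g
∑⊆-rotate n g = trans (∑⊆-∷ n (g ∘ rotate)) (sym (∑⊆-∷ʳ n g))

same : ∀ {n} → Subset n → Subset n → Bool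
same []            []            = true
same (inside  ∷ I) (inside  ∷ J) = same I J
same (outside ∷ I) (outside ∷ J) = same I J
same (inside  ∷ I) (outside ∷ J) = false
same (outside ∷ I) (inside  ∷ J) = false

deletes : ∀ {n} → Subset n → Subset n → Bool
deletes []            []            = false
deletes (inside  ∷ I) (inside  ∷ J) = deletes I J
deletes (outside ∷ I) (inside  ∷ J) = same I J
deletes (inside  ∷ I) (outside ∷ J) = false
deletes (outside ∷ I) (outside ∷ J) = deletes I J

same-sound : ∀ {n} (I J : Subset n) → T (same I J) → I ≡ J
same-sound []            []            _ = refl
same-sound (inside  ∷ I) (inside  ∷ J) t = cong (inside ∷_) (same-sound I J t)
same-sound (outside ∷ I) (outside ∷ J) t = cong (outside ∷_) (same-sound I J t)

same-refl : ∀ {n} (J : Subset n) → T (same J J)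
same-refl []            = _
same-refl (inside  ∷ J) = same-refl J
same-refl (outside ∷ J) = same-refl J

deletes-sound : ∀ {n} (I J : Subset n) → T (deletes I J) → ∃ λ v → v ∈ J × I ≡ J - v
deletes-sound []            []            ()
deletes-sound (inside  ∷ I) (inside  ∷ J) t with deletes-sound I J t
... | v , v∈J , I≡J-v = suc v , there v∈J , cong (inside ∷_) I≡J-v
deletes-sound (outside ∷ I) (outside ∷ J) t with deletes-sound I J t
... | v , v∈J , I≡J-v = suc v , there v∈J , cong (outside ∷_) I≡J-v
deletes-sound (outside ∷ I) (inside  ∷ J) t =
  zero , here , cong (outside ∷_) (trans (same-sound I J t) (sym (p─⊥≡p J)))

deletes-complete : ∀ {n} {v : Fin n} {J : Subset n} → v ∈ J → T (deletes (J - v) J)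
deletes-complete {J = inside ∷ J} here = subst (λ X → T (same X J)) (sym (p─⊥≡p J)) (same-refl J)
deletes-complete {J = inside  ∷ J} (there v∈J) = deletes-complete v∈J
deletes-complete {J = outside ∷ J} (there v∈J) = deletes-complete v∈J

∑⊆-same : ∀ n (J : Subset n) → (∑[ I ⊆ n ] 𝟙 (same I J)) ≡ 1
∑⊆-same zero    []            = refl
∑⊆-same (suc n) (inside  ∷ J) =
  trans (∑⊆-∷ n (λ I → 𝟙 (same I (inside ∷ J)))) (cong₂ _+_ (∑⊆-same n J) (sum-map-zero (allSubsets n)))
∑⊆-same (suc n) (outside ∷ J) =
  trans (∑⊆-∷ n (λ I → 𝟙 (same I (outside ∷ J)))) (cong₂ _+_ (sum-map-zero (allSubsets n)) (∑⊆-same n J))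

∑⊆-deletes : ∀ n (J : Subset n) → (∑[ I ⊆ n ] 𝟙 (deletes I J)) ≡ ∣ J ∣
∑⊆-deletes zero    []            = refl
∑⊆-deletes (suc n) (inside  ∷ J) =
  trans (∑⊆-∷ n (λ I → 𝟙 (deletes I (inside ∷ J))))
        (trans (cong₂ _+_ (∑⊆-deletes n J) (∑⊆-same n J)) (+-comm ∣ J ∣ 1))
∑⊆-deletes (suc n) (outside ∷ J) =
  trans (∑⊆-∷ n (λ I → 𝟙 (deletes I (outside ∷ J))))
        (cong₂ _+_ (sum-map-zero (allSubsets n)) (∑⊆-deletes n J))

∉-removal : ∀ {n} {x v : Fin n} {J : Subset n} → x ∈ J → x ∉ J - v → x ≡ v
∉-removal {x = x} {v} x∈J x∉J-v with x ≟ᶠ v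
... | yes x≡v = x≡v
... | no  x≢v = contradiction (x∈p∧x≢y⇒x∈p-y x∈J x≢v) x∉J-v

independent-⊆ : ∀ {n h} {I J : Subset n} → I ⊆ J → Independent n h J → Independent n h I
independent-⊆ I⊆J indJ i j i∈I j∈I = indJ i j (I⊆J i∈I) (I⊆J j∈I)

-- Covering pairs of the Hasse diagram: I ⋖ J iff J is independent and I is J
-- with one element deleted (independence of I is then inherited).
covers⇔ : ∀ {n h} (I J : Subset n) → Covers n h I J ⇔ (Independent n h J × T (deletes I J))
covers⇔ {n} {h} I J = mk⇔ to from
  where
  to : Covers n h I J → Independent n h J × T (deletes I J)
  to (_ , indJ , (I⊆J , v , v∈J , v∉I) , noK) =
    indJ , subst (λ X → T (deletes X J)) (sym I≡J-v) (deletes-complete v∈J)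
    where
    I⊆J-v : I ⊆ J - v
    I⊆J-v {x} x∈I = x∈p∧x≢y⇒x∈p-y (I⊆J x∈I) (λ x≡v → v∉I (subst (_∈ I) x≡v x∈I))
    J-v⊆I : J - v ⊆ I
    J-v⊆I {x} x∈J-v with x ∈? I
    ... | yes x∈I = x∈I
    ... | no  x∉I = ⊥-elim (noK (J - v , independent-⊆ (p─q⊆p J ⁅ v ⁆) indJ ,
                                 (I⊆J-v , x , x∈J-v , x∉I) , x∈p⇒p-x⊂p v∈J))
    I≡J-v : I ≡ J - v
    I≡J-v = ⊆-antisym I⊆J-v J-v⊆I
  from : Independent n h J × T (deletes I J) → Covers n h I J
  from (indJ , t) with deletes-sound I J t
  ... | v , v∈J , refl = independent-⊆ (p─q⊆p J ⁅ v ⁆) indJ , indJ , x∈p⇒p-x⊂p v∈J , noK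
    where
    noK : ¬ ∃ λ K → Independent n h K × J - v ⊂ K × K ⊂ J
    noK (K , _ , (J-v⊆K , w , w∈K , w∉J-v) , (K⊆J , u , u∈J , u∉K)) =
      u∉K (subst (_∈ K) (trans (∉-removal (K⊆J w∈K) w∉J-v) (sym (∉-removal u∈J (u∉K ∘ J-v⊆K)))) w∈K)

independentᵇ : ∀ n h → Subset n → Bool
independentᵇ n h J = does (independent? n h J)

M-by-top : ∀ n h → M n h ≡ (∑[ J ⊆ n ] 𝟙 (independentᵇ n h J) * ∣ J ∣)
M-by-top n h = begin
  M n h
    ≡⟨ length-filter (λ p → covers? n h (proj₁ p) (proj₂ p)) (cartesianProduct subsets subsets) ⟩
  sum (map (λ p → cover (proj₁ p) (proj₂ p)) (cartesianProduct subsets subsets))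
    ≡⟨ sum-map-cartesianProduct (λ p → cover (proj₁ p) (proj₂ p)) subsets subsets ⟩
  (∑[ I ⊆ n ] (∑[ J ⊆ n ] cover I J))
    ≡⟨ sum-map-comm cover subsets subsets ⟩
  (∑[ J ⊆ n ] (∑[ I ⊆ n ] cover I J))
    ≡⟨ sum-map-cong subsets (λ J → sum-map-cong subsets (λ I → cover-factors I J)) ⟩
  (∑[ J ⊆ n ] (∑[ I ⊆ n ] 𝟙 (independentᵇ n h J) * 𝟙 (deletes I J)))
    ≡⟨ sum-map-cong subsets (λ J → trans (sum-map-*ˡ (𝟙 (independentᵇ n h J)) (λ I → 𝟙 (deletes I J)) subsets)
                                        (cong (𝟙 (independentᵇ n h J) *_) (∑⊆-deletes n J))) ⟩
  (∑[ J ⊆ n ] 𝟙 (independentᵇ n h J) * ∣ J ∣) ∎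
  where
  subsets : List (Subset n)
  subsets = allSubsets n
  cover : Subset n → Subset n → ℕ
  cover I J = 𝟙 (does (covers? n h I J))
  cover-factors : ∀ I J → cover I J ≡ 𝟙 (independentᵇ n h J) * 𝟙 (deletes I J)
  cover-factors I J = trans (cong 𝟙 (does-⇔ (covers⇔ I J) (covers? n h I J) (independent? n h J ×-dec T? (deletes I J))))
                            (𝟙-∧ (independentᵇ n h J) (deletes I J))

at : ∀ {n} → Subset n → ℕ → Bool
at []      _       = false
at (x ∷ X) zero    = x
at (x ∷ X) (suc a) = at X a

at-∈ : ∀ {n} {i : Fin n} {X : Subset n} → i ∈ X → T (at X (toℕ i))
at-∈ here      = tt
at-∈ (there p) = at-∈ p

at-member : ∀ {n} (X : Subset n) a → T (at X a) → ∃ λ i → toℕ i ≡ a × i ∈ X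
at-member (inside ∷ X) zero    _ = zero , refl , here
at-member (x ∷ X)      (suc a) t with at-member X a t
... | i , refl , i∈X = suc i , refl , there i∈X

at-bound : ∀ {n} (X : Subset n) a → T (at X a) → a < n
at-bound (x ∷ X) zero    _ = s≤s z≤n
at-bound (x ∷ X) (suc a) t = s≤s (at-bound X a t)

-- Two members a < b of X are separated in C_n^(h) when both the forward
-- distance b - a and the backward distance n - (b - a) exceed h.
Separated : ℕ → ℕ → ℕ → ℕ → Set
Separated n h a b = a + h < b × b + h < n + a

CyclicGaps : ∀ n → ℕ → Subset n → Set
CyclicGaps n h X = ∀ a b → a < b → T (at X a) → T (at X b) → Separated n h a b

near⇔ : ∀ {a b h} → a ≤ b → b ∸ a ≤ h ⇔ b ≤ a + h
near⇔ {a} {b} {h} a≤b = mk⇔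
  (λ d≤h → subst (_≤ a + h) (m+[n∸m]≡n a≤b) (+-monoʳ-≤ a d≤h))
  (m≤n+o⇒m∸n≤o b a)

far⇔ : ∀ {n a b h} → h ≤ n → a ≤ b → n ∸ h ≤ b ∸ a ⇔ n + a ≤ b + h
far⇔ {n} {a} {b} {h} h≤n a≤b = mk⇔
  (λ le → subst₂ _≤_ (cong (_+ a) (m∸n+n≡m h≤n)) shift (+-monoˡ-≤ a (+-monoˡ-≤ h le)))
  (λ le → m≤n+o⇒m∸n≤o n h (+-cancelʳ-≤ a n (h + (b ∸ a))
            (subst (n + a ≤_) (trans (sym shift) (cong (_+ a) (+-comm (b ∸ a) h))) le)))
  where
  swap-last : ∀ x y z → x + y + z ≡ x + z + y
  swap-last = solve-∀
  shift : b ∸ a + h + a ≡ b + h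
  shift = trans (swap-last (b ∸ a) h a) (cong (_+ h) (m∸n+n≡m a≤b))

Close : ℕ → ℕ → ℕ → Set
Close n h d = d ≤ h ⊎ n ∸ h ≤ d

separated⇔¬close : ∀ {n h a b} → h ≤ n → a ≤ b → Separated n h a b ⇔ (¬ Close n h (b ∸ a))
separated⇔¬close {n} {h} {a} {b} h≤n a≤b = mk⇔
  (λ { (p , q) (inj₁ near) → <⇒≱ p (Equivalence.to (near⇔ a≤b) near)
     ; (p , q) (inj₂ far)  → <⇒≱ q (Equivalence.to (far⇔ h≤n a≤b) far) })
  (λ ¬close → ≰⇒> (¬close ∘ inj₁ ∘ Equivalence.from (near⇔ a≤b)) ,
              ≰⇒> (¬close ∘ inj₂ ∘ Equivalence.from (far⇔ h≤n a≤b)))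

independent⇔gaps : ∀ {n h} → h ≤ n → (X : Subset n) → Independent n h X ⇔ CyclicGaps n h X
independent⇔gaps {n} {h} h≤n X = mk⇔ to from
  where
  to : Independent n h X → CyclicGaps n h X
  to indX a b a<b a∈X b∈X with at-member X a a∈X | at-member X b b∈X
  ... | i , refl , i∈X | j , refl , j∈X =
    Equivalence.from (separated⇔¬close h≤n (<⇒≤ a<b)) λ close →
      indX i j i∈X j∈X ((λ i≡j → <⇒≢ a<b (cong toℕ i≡j)) ,
                        subst (Close n h) (sym (m≤n⇒∣n-m∣≡n∸m (<⇒≤ a<b))) close)
  from : CyclicGaps n h X → Independent n h X
  from gaps i j i∈X j∈X (i≢j , close) with <-cmp (toℕ i) (toℕ j)
  ... | tri< i<j _ _ = Equivalence.to (separated⇔¬close h≤n (<⇒≤ i<j))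
          (gaps (toℕ i) (toℕ j) i<j (at-∈ i∈X) (at-∈ j∈X))
          (subst (Close n h) (m≤n⇒∣n-m∣≡n∸m (<⇒≤ i<j)) close)
  ... | tri≈ _ i≡j _ = i≢j (toℕ-injective i≡j)
  ... | tri> _ _ j<i = Equivalence.to (separated⇔¬close h≤n (<⇒≤ j<i))
          (gaps (toℕ j) (toℕ i) j<i (at-∈ j∈X) (at-∈ i∈X))
          (subst (Close n h) (m≤n⇒∣m-n∣≡n∸m (<⇒≤ j<i)) close)

at-∷ʳ-< : ∀ {m} (X : Subset m) x a → a < m → at (X ∷ʳ x) a ≡ at X a
at-∷ʳ-< (y ∷ X) x zero    _   = refl
at-∷ʳ-< (y ∷ X) x (suc a) a<m = at-∷ʳ-< X x a (s≤s⁻¹ a<m)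

at-∷ʳ-last : ∀ {m} (X : Subset m) x → at (X ∷ʳ x) m ≡ x
at-∷ʳ-last []      x = refl
at-∷ʳ-last (y ∷ X) x = at-∷ʳ-last X x

-- Rotating C_n^(h) by one position preserves the gap condition: pairs of
-- positions (a+1, b+1) become (a, b), and pairs (0, b+1) become (b, n-1).
module _ {m h : ℕ} (x : Bool) (X : Subset m) where

  gaps-rotate : CyclicGaps (suc m) h (x ∷ X) → CyclicGaps (suc m) h (X ∷ʳ x)
  gaps-rotate gaps a b a<b a∈ b∈ with <-cmp b m
  ... | tri< b<m _ _ =
    let (p , q) = gaps (suc a) (suc b) (s≤s a<b) a∈X b∈X
    in s≤s⁻¹ p , subst (b + h <_) (+-suc m a) (s≤s⁻¹ q)
    where
    a∈X : T (at X a)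
    a∈X = subst T (at-∷ʳ-< X x a (<-trans a<b b<m)) a∈
    b∈X : T (at X b)
    b∈X = subst T (at-∷ʳ-< X x b b<m) b∈
  ... | tri≈ _ refl _ =
    let (p , q) = gaps 0 (suc a) (s≤s z≤n) x∈ a∈X
    in subst (a + h <_) (+-identityʳ m) (s≤s⁻¹ q) , s≤s (+-monoʳ-≤ m (s≤s⁻¹ p))
    where
    x∈ : T x
    x∈ = subst T (at-∷ʳ-last X x) b∈
    a∈X : T (at X a)
    a∈X = subst T (at-∷ʳ-< X x a a<b) a∈
  ... | tri> _ _ m<b = contradiction (s≤s⁻¹ (at-bound (X ∷ʳ x) b b∈)) (<⇒≱ m<b)

  gaps-unrotate : CyclicGaps (suc m) h (X ∷ʳ x) → CyclicGaps (suc m) h (x ∷ X)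
  gaps-unrotate gaps zero (suc b) _ x∈ b∈X =
    let b<m = at-bound X b b∈X
        (p , q) = gaps b m b<m (subst T (sym (at-∷ʳ-< X x b b<m)) b∈X) (subst T (sym (at-∷ʳ-last X x)) x∈)
    in s≤s (+-cancelˡ-≤ m h b (s≤s⁻¹ q)) , subst (suc b + h <_) (sym (+-identityʳ (suc m))) (s≤s p)
  gaps-unrotate gaps (suc a) (suc b) a<b a∈X b∈X =
    let (p , q) = gaps a b (s≤s⁻¹ a<b) (subst T (sym (at-∷ʳ-< X x a (at-bound X a a∈X))) a∈X)
                                        (subst T (sym (at-∷ʳ-< X x b (at-bound X b b∈X))) b∈X)
    in s≤s p , s≤s (subst (b + h <_) (sym (+-suc m a)) q)

independent-rotate : ∀ {m h} → h ≤ suc m → (X : Subset (suc m)) →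
                     Independent (suc m) h (rotate X) ⇔ Independent (suc m) h X
independent-rotate {m} {h} h≤n (x ∷ X) = mk⇔
  (Equivalence.from (gaps (x ∷ X)) ∘ gaps-unrotate x X ∘ Equivalence.to (gaps (X ∷ʳ x)))
  (Equivalence.from (gaps (X ∷ʳ x)) ∘ gaps-rotate x X ∘ Equivalence.to (gaps (x ∷ X)))
  where
  gaps : (Y : Subset (suc m)) → Independent (suc m) h Y ⇔ CyclicGaps (suc m) h Y
  gaps = independent⇔gaps h≤n

Within : ℕ → ℕ → ∀ {m} → Subset m → Set
Within lo hi X = ∀ b → T (at X b) → lo ≤ b × b < hi

within-∸1⇒ : ∀ lo hi b → lo ∸ 1 ≤ b × b < hi ∸ 1 → lo ≤ suc b × suc b < hi
within-∸1⇒ lo (suc hi) b (lo≤ , b<) = ≤-trans (m≤n+m∸n lo 1) (s≤s lo≤) , s≤s b<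

within-∸1⇐ : ∀ lo hi b → lo ≤ suc b × suc b < hi → lo ∸ 1 ≤ b × b < hi ∸ 1
within-∸1⇐ lo (suc hi) b (lo≤ , b<) = m≤n+o⇒m∸n≤o lo 1 lo≤ , s≤s⁻¹ b<

module _ (h : ℕ) where

  -- Members of X are pairwise more than h apart (an independent set of the
  -- h-th power of a path).
  Sparse : ∀ {m} → Subset m → Set
  Sparse X = ∀ a b → a < b → T (at X a) → T (at X b) → a + h < b

  -- Decides Sparse X × Within lo hi X by scanning X from the left; after a
  -- member, the next h positions are excluded by moving lo up to h.
  sparseWithin : ℕ → ℕ → ∀ {m} → Subset m → Bool
  sparseWithin lo       hi       []            = true
  sparseWithin lo       hi       (outside ∷ X) = sparseWithin (lo ∸ 1) (hi ∸ 1) X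
  sparseWithin zero     (suc hi) (inside ∷ X)  = sparseWithin h hi X
  sparseWithin zero     zero     (inside ∷ X)  = false
  sparseWithin (suc lo) hi       (inside ∷ X)  = false

  sparseWithin-sound : ∀ lo hi {m} (X : Subset m) → T (sparseWithin lo hi X) → Sparse X × Within lo hi X
  sparseWithin-sound lo hi [] _ = (λ a b _ ()) , (λ b ())
  sparseWithin-sound lo hi (outside ∷ X) t with sparseWithin-sound (lo ∸ 1) (hi ∸ 1) X t
  ... | sparse , within = sparse′ , within′
    where
    sparse′ : Sparse (outside ∷ X)
    sparse′ (suc a) (suc b) a<b a∈ b∈ = s≤s (sparse a b (s≤s⁻¹ a<b) a∈ b∈)
    within′ : Within lo hi (outside ∷ X)
    within′ (suc b) b∈ = within-∸1⇒ lo hi b (within b b∈)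
  sparseWithin-sound zero (suc hi) (inside ∷ X) t with sparseWithin-sound h hi X t
  ... | sparse , within = sparse′ , within′
    where
    sparse′ : Sparse (inside ∷ X)
    sparse′ zero    (suc b) _   _  b∈ = s≤s (proj₁ (within b b∈))
    sparse′ (suc a) (suc b) a<b a∈ b∈ = s≤s (sparse a b (s≤s⁻¹ a<b) a∈ b∈)
    within′ : Within zero (suc hi) (inside ∷ X)
    within′ zero    _  = z≤n , s≤s z≤n
    within′ (suc b) b∈ = z≤n , s≤s (proj₂ (within b b∈))

  sparseWithin-complete : ∀ lo hi {m} (X : Subset m) → Sparse X → Within lo hi X → T (sparseWithin lo hi X)
  sparseWithin-complete lo hi [] _ _ = tt
  sparseWithin-complete lo hi (outside ∷ X) sparse within = sparseWithin-complete (lo ∸ 1) (hi ∸ 1) X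
    (λ a b a<b a∈ b∈ → s≤s⁻¹ (sparse (suc a) (suc b) (s≤s a<b) a∈ b∈))
    (λ b b∈ → within-∸1⇐ lo hi b (within (suc b) b∈))
  sparseWithin-complete lo hi (inside ∷ X) sparse within with within 0 tt
  sparseWithin-complete .zero (suc hi) (inside ∷ X) sparse within | z≤n , s≤s _ = sparseWithin-complete h hi X
    (λ a b a<b a∈ b∈ → s≤s⁻¹ (sparse (suc a) (suc b) (s≤s a<b) a∈ b∈))
    (λ b b∈ → s≤s⁻¹ (sparse 0 (suc b) (s≤s z≤n) tt b∈) , s≤s⁻¹ (proj₂ (within (suc b) b∈)))

  sparseWithin⇔ : ∀ lo hi {m} (X : Subset m) → T (sparseWithin lo hi X) ⇔ (Sparse X × Within lo hi X)
  sparseWithin⇔ lo hi X = mk⇔ (sparseWithin-sound lo hi X) (λ (s , w) → sparseWithin-complete lo hi X s w)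

  -- F_{w-h+h+1} = F_{w+1}: both are 1 when w < h.
  F-shift : ∀ w → F h (w ∸ h + suc h) ≡ F h (suc w)
  F-shift w with h ≤? w
  ... | yes h≤w = cong (F h) (trans (+-suc (w ∸ h) h) (cong suc (m∸n+n≡m h≤w)))
  ... | no  h≰w = begin
    F h (w ∸ h + suc h) ≡⟨ cong (λ i → F h (i + suc h)) (m≤n⇒m∸n≡0 w≤h) ⟩
    F h (suc h)         ≡⟨ F-initial h (s≤s z≤n) ≤-refl ⟩
    1                   ≡⟨ sym (F-initial h (s≤s z≤n) (s≤s w≤h)) ⟩
    F h (suc w)         ∎
    where
    w≤h : w ≤ h
    w≤h = <⇒≤ (≰⇒> h≰w)

  -- The number of h-sparse subsets of a path with w vertices is F_{w+h+1}.
  pathCount : ℕ → ℕ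
  pathCount w = F h (w + suc h)

  -- A sparse set of a path of w+1 vertices either avoids the first vertex,
  -- or contains it and avoids the next h.
  pathCount-rec : ∀ w → pathCount (suc w) ≡ pathCount w + pathCount (w ∸ h)
  pathCount-rec w = begin
    F h (suc w + suc h)                        ≡⟨ cong (F h ∘ suc) (+-suc w h) ⟩
    F h (suc (suc (w + h)))                    ≡⟨ F-rec h (w + h) ⟩
    F h (suc (w + h)) + F h (suc (w + h) ∸ h)  ≡⟨ cong₂ (λ i j → F h i + F h j) (sym (+-suc w h)) (m+n∸n≡m (suc w) h) ⟩
    F h (w + suc h) + F h (suc w)              ≡⟨ cong (F h (w + suc h) +_) (sym (F-shift w)) ⟩
    pathCount w + pathCount (w ∸ h)            ∎

  count-sparseWithin : ∀ m lo hi → (∑[ X ⊆ m ] 𝟙 (sparseWithin lo hi X)) ≡ pathCount (hi ⊓ m ∸ lo)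
  count-sparseWithin zero lo hi =
    sym (trans (cong (λ i → pathCount (i ∸ lo)) (⊓-zeroʳ hi))
               (trans (cong pathCount (0∸n≡0 lo)) (F-initial h (s≤s z≤n) ≤-refl)))
  count-sparseWithin (suc m) (suc lo) hi =
    trans (∑⊆-∷ m (λ X → 𝟙 (sparseWithin (suc lo) hi X)))
          (trans (cong₂ _+_ (sum-map-zero (allSubsets m)) (count-sparseWithin m lo (hi ∸ 1)))
                 (cong pathCount (shifted hi)))
    where
    shifted : ∀ hi → (hi ∸ 1) ⊓ m ∸ lo ≡ hi ⊓ suc m ∸ suc lo
    shifted zero     = 0∸n≡0 lo
    shifted (suc hi) = refl
  count-sparseWithin (suc m) zero zero =
    trans (∑⊆-∷ m (λ X → 𝟙 (sparseWithin 0 0 X)))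
          (cong₂ _+_ (sum-map-zero (allSubsets m)) (count-sparseWithin m 0 0))
  count-sparseWithin (suc m) zero (suc hi) =
    trans (∑⊆-∷ m (λ X → 𝟙 (sparseWithin 0 (suc hi) X)))
          (trans (cong₂ _+_ (count-sparseWithin m h hi) (count-sparseWithin m 0 hi))
                 (trans (+-comm (pathCount (hi ⊓ m ∸ h)) (pathCount (hi ⊓ m)))
                        (sym (pathCount-rec (hi ⊓ m)))))

below-window : ∀ {b k h} → b < k ∸ h → b + h < k
below-window {b} {k} {h} b<k∸h with h ≤? k
... | yes h≤k = subst (suc b + h ≤_) (m∸n+n≡m h≤k) (+-monoˡ-≤ h b<k∸h)
... | no  h≰k with () ← subst (suc b ≤_) (m≤n⇒m∸n≡0 (<⇒≤ (≰⇒> h≰k))) b<k∸h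

-- An independent set of C_{k+1}^(h) through vertex 0 is vertex 0 together with
-- an h-sparse set of positions 1 … k at cyclic distance more than h from 0,
-- i.e. (shifting positions down by one) an h-sparse set inside [h, k - h).
gaps-through-zero : ∀ {h k} (X : Subset k) →
                    CyclicGaps (suc k) h (inside ∷ X) ⇔ (Sparse h X × Within h (k ∸ h) X)
gaps-through-zero {h} {k} X = mk⇔ to from
  where
  to : CyclicGaps (suc k) h (inside ∷ X) → Sparse h X × Within h (k ∸ h) X
  to gaps = (λ a b a<b a∈ b∈ → s≤s⁻¹ (proj₁ (gaps (suc a) (suc b) (s≤s a<b) a∈ b∈))) ,
            (λ b b∈ → let (p , q) = gaps 0 (suc b) (s≤s z≤n) tt b∈ in
                      s≤s⁻¹ p , m+n≤o⇒m≤o∸n (suc b) (subst (suc b + h ≤_) (+-identityʳ k) (s≤s⁻¹ q)))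
  from : Sparse h X × Within h (k ∸ h) X → CyclicGaps (suc k) h (inside ∷ X)
  from (sparse , within) zero (suc b) _ _ b∈ =
    s≤s (proj₁ (within b b∈)) ,
    subst (suc b + h <_) (sym (+-identityʳ (suc k))) (s≤s (below-window (proj₂ (within b b∈))))
  from (sparse , within) (suc a) (suc b) a<b a∈ b∈ =
    s≤s (sparse a b (s≤s⁻¹ a<b) a∈ b∈) ,
    s≤s (≤-trans (below-window (proj₂ (within b b∈))) (m≤m+n k (suc a)))

count-through-zero : ∀ h k → h ≤ k →
  (∑[ X ⊆ k ] 𝟙 (independentᵇ (suc k) h (inside ∷ X))) ≡ F h (suc k ∸ h)
count-through-zero h k h≤k = begin
  (∑[ X ⊆ k ] 𝟙 (independentᵇ (suc k) h (inside ∷ X)))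
    ≡⟨ sum-map-cong (allSubsets k) (λ X → cong 𝟙 (does-⇔ (characterisation X)
                                       (independent? (suc k) h (inside ∷ X)) (T? (sparseWithin h h (k ∸ h) X)))) ⟩
  (∑[ X ⊆ k ] 𝟙 (sparseWithin h h (k ∸ h) X))
    ≡⟨ count-sparseWithin h k h (k ∸ h) ⟩
  pathCount h ((k ∸ h) ⊓ k ∸ h)
    ≡⟨ cong (λ w → pathCount h (w ∸ h)) (m≤n⇒m⊓n≡m (m∸n≤m k h)) ⟩
  F h (k ∸ h ∸ h + suc h)
    ≡⟨ F-shift h (k ∸ h) ⟩
  F h (suc (k ∸ h))
    ≡⟨ cong (F h) (sym (+-∸-assoc 1 h≤k)) ⟩
  F h (suc k ∸ h) ∎
  where
  characterisation : ∀ X → Independent (suc k) h (inside ∷ X) ⇔ T (sparseWithin h h (k ∸ h) X)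
  characterisation X = ⇔-sym (sparseWithin⇔ h h (k ∸ h) X)
                   ⇔-∘ (gaps-through-zero X ⇔-∘ independent⇔gaps (m≤n⇒m≤1+n h≤k) (inside ∷ X))

throughCount : ∀ n → ℕ → ℕ → ℕ
throughCount n h i = ∑[ J ⊆ n ] 𝟙 (independentᵇ n h J) * 𝟙 (at J i)

-- Rotational symmetry: every vertex lies in equally many independent sets.
throughCount-suc : ∀ {h k i} → h ≤ suc k → i < k → throughCount (suc k) h (suc i) ≡ throughCount (suc k) h i
throughCount-suc {h} {k} {i} h≤n i<k = begin
  (∑[ J ⊆ suc k ] 𝟙 (independentᵇ (suc k) h J) * 𝟙 (at J (suc i)))
    ≡⟨ sum-map-cong (allSubsets (suc k)) (λ J → sym (cong₂ (λ a b → 𝟙 a * 𝟙 b) (rotated-independent J) (at-rotate J))) ⟩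
  (∑[ J ⊆ suc k ] 𝟙 (independentᵇ (suc k) h (rotate J)) * 𝟙 (at (rotate J) i))
    ≡⟨ ∑⊆-rotate k (λ J → 𝟙 (independentᵇ (suc k) h J) * 𝟙 (at J i)) ⟩
  (∑[ J ⊆ suc k ] 𝟙 (independentᵇ (suc k) h J) * 𝟙 (at J i)) ∎
  where
  rotated-independent : ∀ J → independentᵇ (suc k) h (rotate J) ≡ independentᵇ (suc k) h J
  rotated-independent J = does-⇔ (independent-rotate h≤n J) (independent? (suc k) h (rotate J)) (independent? (suc k) h J)
  at-rotate : ∀ J → at (rotate J) i ≡ at J (suc i)
  at-rotate (x ∷ X) = at-∷ʳ-< X x i i<k

throughCount-uniform : ∀ {h k} → h ≤ suc k → ∀ i → i < suc k →
                       throughCount (suc k) h i ≡ throughCount (suc k) h 0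
throughCount-uniform h≤n zero    _   = refl
throughCount-uniform h≤n (suc i) i<n =
  trans (throughCount-suc h≤n (s≤s⁻¹ i<n)) (throughCount-uniform h≤n i (<-trans (n<1+n i) i<n))

throughCount-zero : ∀ h k → h ≤ k → throughCount (suc k) h 0 ≡ F h (suc k ∸ h)
throughCount-zero h k h≤k = begin
  throughCount (suc k) h 0
    ≡⟨ ∑⊆-∷ k (λ J → ι J * 𝟙 (at J 0)) ⟩
  (∑[ X ⊆ k ] ι (inside ∷ X) * 1) + (∑[ X ⊆ k ] ι (outside ∷ X) * 0)
    ≡⟨ cong₂ _+_ (sum-map-cong (allSubsets k) (λ X → *-identityʳ (ι (inside ∷ X))))
                 (trans (sum-map-cong (allSubsets k) (λ X → *-zeroʳ (ι (outside ∷ X))))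
                        (sum-map-zero (allSubsets k))) ⟩
  (∑[ X ⊆ k ] ι (inside ∷ X)) + 0
    ≡⟨ +-identityʳ _ ⟩
  (∑[ X ⊆ k ] ι (inside ∷ X))
    ≡⟨ count-through-zero h k h≤k ⟩
  F h (suc k ∸ h) ∎
  where
  ι : Subset (suc k) → ℕ
  ι J = 𝟙 (independentᵇ (suc k) h J)

card-at : ∀ {n} (J : Subset n) → ∣ J ∣ ≡ (∑[ i < n ] 𝟙 (at J i))
card-at []            = refl
card-at (inside  ∷ J) = cong suc (card-at J)
card-at (outside ∷ J) = card-at J

M-closed : ∀ n h → h < n → M n h ≡ n * F h (n ∸ h)
M-closed (suc k) h (s≤s h≤k) = begin
  M n h
    ≡⟨ M-by-top n h ⟩
  (∑[ J ⊆ n ] ι J * ∣ J ∣)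
    ≡⟨ sum-map-cong (allSubsets n) (λ J → trans (cong (ι J *_) (card-at J)) (∑-*ˡ (ι J) n (λ i → 𝟙 (at J i)))) ⟩
  (∑[ J ⊆ n ] (∑[ i < n ] ι J * 𝟙 (at J i)))
    ≡⟨ sum-map-∑< n (λ J i → ι J * 𝟙 (at J i)) (allSubsets n) ⟩
  (∑[ i < n ] throughCount n h i)
    ≡⟨ ∑-cong n (throughCount-uniform (m≤n⇒m≤1+n h≤k)) ⟩
  (∑[ i < n ] throughCount n h 0)
    ≡⟨ ∑-const n (throughCount n h 0) ⟩
  n * throughCount n h 0
    ≡⟨ cong (n *_) (throughCount-zero h k h≤k) ⟩
  n * F h (n ∸ h) ∎
  where
  n : ℕ
  n = suc k
  ι : Subset n → ℕ
  ι J = 𝟙 (independentᵇ n h J)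

theorem5p1 : (n h : ℕ) → h < n → M n h ≡ fibLucSum n h
theorem5p1 n h h<n = trans (M-closed n h h<n) (sym (fibLucSum-closed n h h<n))
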